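{- Let $a,b,c,d$ be real numbers with $a+b=c+d$, let $n\ge 2$, and let $k_1,\dots,k_n$ be real numbers. Define finite sequences $x^{(m)}=(x^{(m)}_1,\dots,x^{(m)}_{2^m})$ and $y^{(m)}=(y^{(m)}_1,\dots,y^{(m)}_{2^m})$ for $1\le m\le n$ recursively by $x^{(1)}=(a+k_1,\;b+k_1)$, $y^{(1)}=(c+k_1,\;d+k_1)$, and for $2\le m\le n$ and $1\le j\le 2^{m-1}$: $x^{(m)}_j=x^{(m-1)}_j$, $x^{(m)}_{2^{m-1}+j}=y^{(m-1)}_j+k_m$, $y^{(m)}_j=y^{(m-1)}_j$, $y^{(m)}_{2^{m-1}+j}=x^{(m-1)}_j+k_m$. Let $M^1=\sum_{i=1}^{2^n}x^{(n)}_i$. If the number $a+b+2k_1+\sum_{i=2}^n k_i$ is an integer, then $M^1$ is an even integer, i.e. $M^1\equiv 0 \pmod 2$.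
   Context: All numbers are real. -}

module Defs where

open import Level using (Level)
open import Algebra.Bundles using (CommutativeRing)
open import Data.Nat using (ℕ; zero; suc)
open import Data.Integer using (ℤ; +_; -[1+_])
open import Data.List using (List; []; _∷_; _++_; map; foldl; foldr)
open import Data.Product using (_×_; _,_; proj₁)

module WithRing {c ℓ : Level} (R : CommutativeRing c ℓ) where
  open CommutativeRing R

  fromℕ : ℕ → Carrier
  fromℕ zero    = 0#
  fromℕ (suc n) = 1# + fromℕ n

  -- canonical image of z : ℤ in R ("is an integer" = equals some fromℤ z)
  fromℤ : ℤ → Carrier
  fromℤ (+ n)      = fromℕ n
  fromℤ -[1+ n ]   = - fromℕ (suc n)

  sumR : List Carrier → Carrier
  sumR = foldr _+_ 0#

  step : List Carrier × List Carrier → Carrier → List Carrier × List Carrier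
  step (x , y) k = (x ++ map (_+ k) y , y ++ map (_+ k) x)

  -- (x^(n), y^(n)) for k₁ and ks = (k₂, …, k_n)
  seqs : (a b c d k₁ : Carrier) → List Carrier → List Carrier × List Carrier
  seqs a b c d k₁ ks =
    foldl step ((a + k₁) ∷ (b + k₁) ∷ [] , (c + k₁) ∷ (d + k₁) ∷ []) ks

  M¹ : (a b c d k₁ : Carrier) → List Carrier → Carrier
  M¹ a b c d k₁ ks = sumR (proj₁ (seqs a b c d k₁ ks))

-- Every step replaces a pair of sequences of length 2p, both summing to p·u,
-- by a pair of sequences of length 4p, both summing to 2p·(u + k): the new x
-- consists of x and of y shifted by k.  The hypothesis a + b = c + d makes the
-- first pair of this shape with p = 1, so after the n − 1 steps both sums equal
-- 2^(n−1) · (a + b + 2k₁ + k₂ + ⋯ + kₙ), an even multiple of an integer as n ≥ 2.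
{-# OPTIONS --safe #-}
module Submission where

open import Defs
open import Level using (Level)
open import Algebra.Bundles using (CommutativeRing)
open import Data.Nat using (_≤_)
open import Data.Integer using (ℤ; +_; _*_)
open import Data.List using (List; length)
open import Data.Product using (∃)

open import Data.Nat as ℕ using (ℕ; zero; suc; _^_)
import Data.Nat.Properties as ℕₚ
open import Data.Nat.Tactic.RingSolver using (solve-∀)
import Data.Integer as ℤ
import Data.Integer.Properties as ℤ
open import Data.List using ([]; _∷_; _++_; map; foldl)
open import Data.List.Properties using (length-++; length-map)
import Data.Product as Product
open import Data.Product using (_,_; proj₁; proj₂)
open import Relation.Binary.PropositionalEquality as ≡ using (_≡_)

module _ {c ℓ : Level} (R : CommutativeRing c ℓ) where
  open CommutativeRing R hiding (_*_)
  open WithRing R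
  open import Algebra.Properties.Ring ring using (-0#≈0#; -‿+-comm)
  open import Algebra.Properties.CommutativeMonoid.Mult +-commutativeMonoid
    using (_×_; ×-cong; ×-homo-+; ×-distrib-+)
  open import Algebra.Properties.CommutativeSemigroup +-commutativeSemigroup
    using (interchange)
  open import Relation.Binary.Reasoning.Setoid setoid

  fromℕ-+ : ∀ m n → fromℕ (m ℕ.+ n) ≈ fromℕ m + fromℕ n
  fromℕ-+ zero    n = sym (+-identityˡ (fromℕ n))
  fromℕ-+ (suc m) n = trans (+-congˡ (fromℕ-+ m n)) (sym (+-assoc 1# (fromℕ m) (fromℕ n)))

  fromℕ-* : ∀ m n → fromℕ (m ℕ.* n) ≈ m × fromℕ n
  fromℕ-* zero    n = refl
  fromℕ-* (suc m) n = trans (fromℕ-+ n (m ℕ.* n)) (+-congˡ (fromℕ-* m n))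

  fromℤ-neg : ∀ n → fromℤ (ℤ.- (+ n)) ≈ - fromℕ n
  fromℤ-neg zero    = sym -0#≈0#
  fromℤ-neg (suc n) = refl

  ×-neg : ∀ n x → n × (- x) ≈ - (n × x)
  ×-neg zero    x = sym -0#≈0#
  ×-neg (suc n) x = trans (+-congˡ (×-neg n x)) (-‿+-comm x (n × x))

  fromℤ-* : ∀ n z → fromℤ (+ n * z) ≈ n × fromℤ z
  fromℤ-* n (+ m) = trans (reflexive (≡.cong fromℤ (≡.sym (ℤ.pos-* n m)))) (fromℕ-* n m)
  fromℤ-* n ℤ.-[1+ m ] = begin
    fromℤ (+ n * ℤ.-[1+ m ])           ≡⟨ ≡.cong fromℤ (≡.sym (ℤ.neg-distribʳ-* (+ n) (+ suc m))) ⟩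
    fromℤ (ℤ.- (+ n * + suc m))        ≡⟨ ≡.cong (λ i → fromℤ (ℤ.- i)) (≡.sym (ℤ.pos-* n (suc m))) ⟩
    fromℤ (ℤ.- (+ (n ℕ.* suc m)))      ≈⟨ fromℤ-neg (n ℕ.* suc m) ⟩
    - fromℕ (n ℕ.* suc m)              ≈⟨ -‿cong (fromℕ-* n (suc m)) ⟩
    - (n × fromℕ (suc m))              ≈⟨ ×-neg n (fromℕ (suc m)) ⟨
    n × fromℤ ℤ.-[1+ m ]               ∎

  sumR-++ : ∀ xs ys → sumR (xs ++ ys) ≈ sumR xs + sumR ys
  sumR-++ []       ys = sym (+-identityˡ (sumR ys))
  sumR-++ (x ∷ xs) ys = trans (+-congˡ (sumR-++ xs ys)) (sym (+-assoc x (sumR xs) (sumR ys)))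

  sumR-map-+ : ∀ k ys → sumR (map (_+ k) ys) ≈ sumR ys + length ys × k
  sumR-map-+ k []       = sym (+-identityʳ 0#)
  sumR-map-+ k (y ∷ ys) = trans (+-congˡ (sumR-map-+ k ys)) (interchange y k (sumR ys) (length ys × k))

  record Balanced (p : ℕ) (u : Carrier) (xy : List Carrier Product.× List Carrier) : Set (c Level.⊔ ℓ) where
    field
      length₁ : length (proj₁ xy) ≡ p ℕ.+ p
      length₂ : length (proj₂ xy) ≡ p ℕ.+ p
      sum₁    : sumR (proj₁ xy) ≈ p × u
      sum₂    : sumR (proj₂ xy) ≈ p × u

  step-sum : ∀ {p u} x y k → length y ≡ p ℕ.+ p → sumR x ≈ p × u → sumR y ≈ p × u →
             sumR (x ++ map (_+ k) y) ≈ (p ℕ.+ p) × (u + k)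
  step-sum {p} {u} x y k ∣y∣ Σx Σy = begin
    sumR (x ++ map (_+ k) y)               ≈⟨ sumR-++ x (map (_+ k) y) ⟩
    sumR x + sumR (map (_+ k) y)           ≈⟨ +-congˡ (sumR-map-+ k y) ⟩
    sumR x + (sumR y + length y × k)       ≈⟨ +-cong Σx (+-cong Σy (×-cong ∣y∣ refl)) ⟩
    p × u + (p × u + (p ℕ.+ p) × k)        ≈⟨ +-assoc (p × u) (p × u) ((p ℕ.+ p) × k) ⟨
    (p × u + p × u) + (p ℕ.+ p) × k        ≈⟨ +-congʳ (×-homo-+ u p p) ⟨
    (p ℕ.+ p) × u + (p ℕ.+ p) × k          ≈⟨ ×-distrib-+ u k (p ℕ.+ p) ⟨
    (p ℕ.+ p) × (u + k)                    ∎

  step-balanced : ∀ {p u xy} k → Balanced p u xy → Balanced (p ℕ.+ p) (u + k) (step xy k)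
  step-balanced {p} {u} {x , y} k b = record
    { length₁ = ≡.trans (length-++ x) (≡.cong₂ ℕ._+_ length₁ (≡.trans (length-map (_+ k) y) length₂))
    ; length₂ = ≡.trans (length-++ y) (≡.cong₂ ℕ._+_ length₂ (≡.trans (length-map (_+ k) x) length₁))
    ; sum₁    = step-sum {p} {u} x y k length₂ sum₁ sum₂
    ; sum₂    = step-sum {p} {u} y x k length₁ sum₂ sum₁
    }
    where open Balanced b

  foldl-step-sum : ∀ {p u xy} ks → Balanced p u xy →
                   sumR (proj₁ (foldl step xy ks)) ≈ (p ℕ.* 2 ^ length ks) × (u + sumR ks)
  foldl-step-sum {p} {u} [] b =
    trans (Balanced.sum₁ b) (×-cong (≡.sym (ℕₚ.*-identityʳ p)) (sym (+-identityʳ u)))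
  foldl-step-sum {p} {u} {xy} (k ∷ ks) b = begin
    sumR (proj₁ (foldl step (step xy k) ks))         ≈⟨ foldl-step-sum ks (step-balanced k b) ⟩
    ((p ℕ.+ p) ℕ.* 2 ^ length ks) × (u + k + sumR ks) ≈⟨ ×-cong (doubling p (2 ^ length ks)) (+-assoc u k (sumR ks)) ⟩
    (p ℕ.* 2 ^ suc (length ks)) × (u + sumR (k ∷ ks)) ∎
    where
    doubling : ∀ p q → (p ℕ.+ p) ℕ.* q ≡ p ℕ.* (2 ℕ.* q)
    doubling = solve-∀

  pair-sum : ∀ a b k → (a + k) + ((b + k) + 0#) ≈ 1 × (a + b + (k + k))
  pair-sum a b k = begin
    (a + k) + ((b + k) + 0#)  ≈⟨ +-congˡ (+-identityʳ (b + k)) ⟩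
    (a + k) + (b + k)         ≈⟨ interchange a k b k ⟩
    a + b + (k + k)           ≈⟨ +-identityʳ (a + b + (k + k)) ⟨
    1 × (a + b + (k + k))     ∎

  initial-balanced : ∀ {a b c d} k → a + b ≈ c + d →
                     Balanced 1 (a + b + (k + k)) ((a + k) ∷ (b + k) ∷ [] , (c + k) ∷ (d + k) ∷ [])
  initial-balanced {a} {b} {c} {d} k a+b≈c+d = record
    { length₁ = ≡.refl
    ; length₂ = ≡.refl
    ; sum₁    = pair-sum a b k
    ; sum₂    = trans (pair-sum c d k) (×-cong {1} ≡.refl (+-congʳ (sym a+b≈c+d)))
    }

  M¹-closed-form : ∀ {a b c d} k₁ ks → a + b ≈ c + d →
                   M¹ a b c d k₁ ks ≈ (2 ^ length ks) × (a + b + (k₁ + k₁) + sumR ks)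
  M¹-closed-form k₁ ks a+b≈c+d =
    trans (foldl-step-sum ks (initial-balanced k₁ a+b≈c+d)) (×-cong (ℕₚ.*-identityˡ (2 ^ length ks)) refl)

mainTheorem5 : {c ℓ : Level} (R : CommutativeRing c ℓ) →
    let open CommutativeRing R renaming (_*_ to _*R_) in
    let open WithRing R in
    (a b c d k₁ : Carrier) (ks : List Carrier) →
    a + b ≈ c + d →
    1 ≤ length ks →
    (z : ℤ) → a + b + (k₁ + k₁) + sumR ks ≈ fromℤ z →
    ∃ λ (w : ℤ) → M¹ a b c d k₁ ks ≈ fromℤ ((+ 2) * w)
mainTheorem5 R a b c d k₁ ks@(_ ∷ ks′) a+b≈c+d _ z sum≈z = + (2 ^ length ks′) * z , (begin
  M¹ a b c d k₁ ks                                 ≈⟨ M¹-closed-form R k₁ ks a+b≈c+d ⟩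
  (2 ^ length ks) × (a + b + (k₁ + k₁) + sumR ks)  ≈⟨ ×-congʳ (2 ^ length ks) sum≈z ⟩
  (2 ^ length ks) × fromℤ z                        ≈⟨ fromℤ-* R (2 ^ length ks) z ⟨
  fromℤ (+ (2 ^ length ks) * z)                    ≡⟨ ≡.cong (λ i → fromℤ (i * z)) (ℤ.pos-* 2 (2 ^ length ks′)) ⟩
  fromℤ (+ 2 * + (2 ^ length ks′) * z)             ≡⟨ ≡.cong fromℤ (ℤ.*-assoc (+ 2) (+ (2 ^ length ks′)) z) ⟩
  fromℤ (+ 2 * (+ (2 ^ length ks′) * z))           ∎)
  where
  open CommutativeRing R using (_≈_; _+_; setoid; +-commutativeMonoid)
  open WithRing R
  open import Algebra.Properties.CommutativeMonoid.Mult +-commutativeMonoid using (_×_; ×-congʳ)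
  open import Relation.Binary.Reasoning.Setoid setoid
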